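{- For each even integer $n\ge4$ there exists a $2$-IMOFS$(n;n-2)$, i.e. a pair of orthogonal incomplete frequency squares of type $(n;n-2)$.
   Context: For positive even integers $s<n$, an incomplete frequency square of type $(n;s)$ is an $n\times n$ array indexed by $\{1,\dots,n\}^2$ whose cells in $\{1,\dots,s\}\times\{1,\dots,s\}$ are empty, whose other cells contain $0$ or $1$, and in which every row and every column contains equally many $0$'s and $1$'s. Two such arrays are orthogonal if, when superimposed (on the non-empty cells), each of the ordered pairs $(0,0),(0,1),(1,0),(1,1)$ occurs the same number of times. A $k$-IMOFS$(n;s)$ is a set of $k$ pairwise orthogonal incomplete frequency squares of type $(n;s)$. -}

module Defs where

open import Data.Nat using (ℕ; _<_; _<?_; _*_; _+_)
open import Data.Nat.Properties using ()
open import Data.Bool using (Bool; true; false)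
open import Data.Bool.Properties using () renaming (_≟_ to _≟ᵇ_)
open import Data.Fin using (Fin; toℕ)
open import Data.List using (List; length; filter; concatMap; map)
open import Data.List using () renaming (allFin to allFinL)
open import Data.Product using (_×_; _,_; proj₁; proj₂; Σ)
open import Relation.Binary.PropositionalEquality using (_≡_)
open import Relation.Nullary using (Dec; ¬_)
open import Relation.Nullary.Decidable using (_×-dec_; ¬?)

-- An n×n array with entries 0/1, encoded as false = 0, true = 1.
-- Cells are indexed by Fin n × Fin n, i.e. {0..n-1}^2 (a shift of {1..n}^2).
-- Entries in the empty cells are irrelevant (ignored everywhere).
Array : ℕ → Set
Array n = Fin n → Fin n → Bool

Empty : ℕ → {n : ℕ} → Fin n → Fin n → Set
Empty s i j = (toℕ i < s) × (toℕ j < s)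

empty? : (s : ℕ) → {n : ℕ} → (i j : Fin n) → Dec (Empty s i j)
empty? s i j = (toℕ i <? s) ×-dec (toℕ j <? s)

cells : (n : ℕ) → List (Fin n × Fin n)
cells n = concatMap (λ i → map (λ j → (i , j)) (allFinL n)) (allFinL n)

rowCount : {n : ℕ} → ℕ → Array n → Fin n → Bool → ℕ
rowCount {n} s L i b =
  length (filter (λ j → ¬? (empty? s i j) ×-dec (L i j ≟ᵇ b)) (allFinL n))

colCount : {n : ℕ} → ℕ → Array n → Fin n → Bool → ℕ
colCount {n} s L j b =
  length (filter (λ i → ¬? (empty? s i j) ×-dec (L i j ≟ᵇ b)) (allFinL n))

IsIFS : (n s : ℕ) → Array n → Set
IsIFS n s L =
  (∀ i → rowCount s L i false ≡ rowCount s L i true) ×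
  (∀ j → colCount s L j false ≡ colCount s L j true)

pairCount : {n : ℕ} → ℕ → Array n → Array n → Bool → Bool → ℕ
pairCount {n} s L M a b =
  length (filter (λ c → ¬? (empty? s (proj₁ c) (proj₂ c)) ×-dec
                         ((L (proj₁ c) (proj₂ c) ≟ᵇ a) ×-dec (M (proj₁ c) (proj₂ c) ≟ᵇ b)))
                 (cells n))

Orthogonal : (n s : ℕ) → Array n → Array n → Set
Orthogonal n s L M =
  (pairCount s L M false false ≡ pairCount s L M false true) ×
  (pairCount s L M false false ≡ pairCount s L M true false) ×
  (pairCount s L M false false ≡ pairCount s L M true true)

TwoIMOFS : (n s : ℕ) → Set
TwoIMOFS n s = Σ (Array n) λ L → Σ (Array n) λ M →
  IsIFS n s L × IsIFS n s M × Orthogonal n s L M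

-- A pair of ℕ-indexed grids with side
-- s + 2 and an s × s hole is bordered by two rows on top and two columns on the
-- left, whose non-empty cells form four dominoes carrying complementary entries,
-- so every line stays balanced.  Flipping only the top rows of the second square
-- makes the eight new cells show each ordered pair exactly twice, so all four
-- pair counts grow by 2.  Starting from a 4 × 4 pair in which every pair occurs
-- three times, the square of side 2k has every pair exactly 2k − 1 times.
module Submission where

open import Defs
open import Data.Bool using (Bool; true; false; not; _∧_; _xor_; if_then_else_)
open import Data.Bool.Properties using (T-≡; not-distribʳ-xor; ∧-zeroʳ) renaming (_≟_ to _≟ᵇ_)
open import Data.Fin using (Fin; toℕ; zero; suc)
open import Data.Fin.Properties using (toℕ<n)
open import Data.List using (List; _++_; length; filter; map; concat; tabulate)
open import Data.List.Properties using (filter-++; length-++; map-tabulate)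
open import Data.Nat using (ℕ; zero; suc; _+_; _*_; _∸_; _≤_; _<_; _<ᵇ_; _≡ᵇ_; s≤s; z≤n)
open import Data.Nat.Properties
  using (<⇒<ᵇ; ≡⇒≡ᵇ; ≤-trans; m≤m+n; +-assoc; +-identityʳ; *-suc; +-commutativeSemigroup)
open import Algebra.Properties.CommutativeSemigroup +-commutativeSemigroup using (interchange)
open import Data.Product using (_×_; _,_)
open import Function using (_∘_; id; Equivalence)
open import Level using (0ℓ)
open import Relation.Binary.PropositionalEquality
open import Relation.Nullary using (does)
open import Relation.Unary using (Pred; Decidable)

open ≡-Reasoning

bit : Bool → ℕ
bit b = if b then 1 else 0

count : ℕ → (ℕ → Bool) → ℕ
count zero    q = 0
count (suc n) q = bit (q 0) + count n (q ∘ suc)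

count² : ℕ → ℕ → (ℕ → ℕ → Bool) → ℕ
count² zero    n q = 0
count² (suc m) n q = count n (q 0) + count² m n (q ∘ suc)

count-false-prefix : ∀ m q → (∀ j → j < m → q j ≡ false) →
                     count (2 + m) q ≡ bit (q m) + bit (q (suc m))
count-false-prefix zero    q _     = cong (bit (q 0) +_) (+-identityʳ (bit (q 1)))
count-false-prefix (suc m) q prefix rewrite prefix 0 (s≤s z≤n) =
  count-false-prefix m (q ∘ suc) (λ j j<m → prefix (suc j) (s≤s j<m))

count²-sucʳ : ∀ m n q → count² m (suc n) q ≡ count m (λ i → q i 0) + count² m n (λ i j → q i (suc j))
count²-sucʳ zero    n q = refl
count²-sucʳ (suc m) n q
  rewrite count²-sucʳ m n (q ∘ suc) = interchange (bit (q 0 0)) (count n (q 0 ∘ suc)) _ _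

count²-peel : ∀ m q → count² (2 + m) (2 + m) q ≡
  count (2 + m) (q 0) + (count (2 + m) (q 1) +
  (count m (λ i → q (2 + i) 0) + (count m (λ i → q (2 + i) 1) +
   count² m m (λ i j → q (2 + i) (2 + j)))))
count²-peel m q = cong (λ rest → count (2 + m) (q 0) + (count (2 + m) (q 1) + rest))
  (trans (count²-sucʳ m (suc m) (λ i → q (2 + i)))
         (cong (count m (λ i → q (2 + i) 0) +_) (count²-sucʳ m m (λ i j → q (2 + i) (suc j)))))

length-filter-tabulate : ∀ {A : Set} {P : Pred A 0ℓ} (P? : Decidable P) n (g : Fin n → A) q →
  (∀ x → does (P? (g x)) ≡ q (toℕ x)) → length (filter P? (tabulate g)) ≡ count n q
length-filter-tabulate P? zero    g q agree = refl
length-filter-tabulate P? (suc n) g q agree with does (P? (g zero)) | agree zero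
... | false | q₀ rewrite sym q₀ = length-filter-tabulate P? n (g ∘ suc) (q ∘ suc) (agree ∘ suc)
... | true  | q₀ rewrite sym q₀ = cong suc (length-filter-tabulate P? n (g ∘ suc) (q ∘ suc) (agree ∘ suc))

length-filter-++ : ∀ {A : Set} {P : Pred A 0ℓ} (P? : Decidable P) (xs ys : List A) →
  length (filter P? (xs ++ ys)) ≡ length (filter P? xs) + length (filter P? ys)
length-filter-++ P? xs ys = trans (cong length (filter-++ P? xs ys)) (length-++ (filter P? xs))

length-filter-cells : ∀ {n} {P : Pred (Fin n × Fin n) 0ℓ} (P? : Decidable P) m (g : Fin m → Fin n) q →
  (∀ x y → does (P? (g x , y)) ≡ q (toℕ x) (toℕ y)) →
  length (filter P? (concat (map (λ i → map (i ,_) (tabulate id)) (tabulate g)))) ≡ count² m n q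
length-filter-cells P? zero    g q agree = refl
length-filter-cells {n} P? (suc m) g q agree = begin
  length (filter P? (map (g zero ,_) (tabulate id) ++ _))
    ≡⟨ length-filter-++ P? (map (g zero ,_) (tabulate id)) _ ⟩
  length (filter P? (map (g zero ,_) (tabulate id))) + _
    ≡⟨ cong₂ _+_ first-row (length-filter-cells P? m (g ∘ suc) (q ∘ suc) (agree ∘ suc)) ⟩
  count n (q 0) + count² m n (q ∘ suc) ∎
  where
  first-row : length (filter P? (map (g zero ,_) (tabulate id))) ≡ count n (q 0)
  first-row = trans (cong (length ∘ filter P?) (map-tabulate id (g zero ,_)))
                    (length-filter-tabulate P? n (g zero ,_) (q 0) (agree zero))

<ᵇ-true : ∀ {m n} → m < n → (m <ᵇ n) ≡ true
<ᵇ-true m<n = Equivalence.to T-≡ (<⇒<ᵇ m<n)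

<ᵇ-irrefl : ∀ n → (n <ᵇ n) ≡ false
<ᵇ-irrefl zero    = refl
<ᵇ-irrefl (suc n) = <ᵇ-irrefl n

suc<ᵇ-false : ∀ n → (suc n <ᵇ n) ≡ false
suc<ᵇ-false zero    = refl
suc<ᵇ-false (suc n) = suc<ᵇ-false n

≡ᵇ-refl : ∀ n → (n ≡ᵇ n) ≡ true
≡ᵇ-refl n = Equivalence.to T-≡ (≡⇒≡ᵇ n n refl)

suc≡ᵇ-false : ∀ n → (suc n ≡ᵇ n) ≡ false
suc≡ᵇ-false zero    = refl
suc≡ᵇ-false (suc n) = suc≡ᵇ-false n

_=ᵇ_ : Bool → Bool → Bool
x =ᵇ y = does (x ≟ᵇ y)

-- A line whose empty cells are marked by h and whose entries are v; in this
-- shape tally agrees definitionally with rowCount and colCount.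
tally : ℕ → (ℕ → Bool) → (ℕ → Bool) → Bool → ℕ
tally n h v b = count n (λ j → not (h j) ∧ (v j =ᵇ b))

Balanced : ℕ → (ℕ → Bool) → (ℕ → Bool) → Set
Balanced n h v = tally n h v false ≡ tally n h v true

domino : ∀ e x b → bit (not e ∧ (x =ᵇ b)) + bit (not e ∧ (not x =ᵇ b)) ≡ bit (not e)
domino true  x     b     = refl
domino false false false = refl
domino false false true  = refl
domino false true  false = refl
domino false true  true  = refl

tally-cons-domino : ∀ m (h v : ℕ → Bool) → h 1 ≡ h 0 → v 1 ≡ not (v 0) → ∀ b →
  tally (2 + m) h v b ≡ bit (not (h 0)) + tally m (h ∘ (2 +_)) (v ∘ (2 +_)) b
tally-cons-domino m h v h₁ v₁ b rewrite h₁ | v₁ =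
  trans (sym (+-assoc (bit (not (h 0) ∧ (v 0 =ᵇ b))) (bit (not (h 0) ∧ (not (v 0) =ᵇ b))) _))
        (cong (_+ tally m (h ∘ (2 +_)) (v ∘ (2 +_)) b) (domino (h 0) (v 0) b))

balanced-cons-domino : ∀ m (h v : ℕ → Bool) → h 1 ≡ h 0 → v 1 ≡ not (v 0) →
  Balanced m (h ∘ (2 +_)) (v ∘ (2 +_)) → Balanced (2 + m) h v
balanced-cons-domino m h v h₁ v₁ balanced = begin
  tally (2 + m) h v false                               ≡⟨ tally-cons-domino m h v h₁ v₁ false ⟩
  bit (not (h 0)) + tally m (h ∘ (2 +_)) (v ∘ (2 +_)) false ≡⟨ cong (bit (not (h 0)) +_) balanced ⟩
  bit (not (h 0)) + tally m (h ∘ (2 +_)) (v ∘ (2 +_)) true  ≡⟨ tally-cons-domino m h v h₁ v₁ true ⟨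
  tally (2 + m) h v true                                ∎

tally-hole-domino : ∀ m (h v : ℕ → Bool) → (∀ j → j < m → h j ≡ true) →
  h m ≡ false → h (suc m) ≡ false → v (suc m) ≡ not (v m) → ∀ b → tally (2 + m) h v b ≡ 1
tally-hole-domino m h v prefix hₘ hₘ₊₁ vₘ₊₁ b
  rewrite count-false-prefix m (λ j → not (h j) ∧ (v j =ᵇ b))
            (λ j j<m → cong (λ e → not e ∧ (v j =ᵇ b)) (prefix j j<m))
        | hₘ | hₘ₊₁ | vₘ₊₁ = domino false (v m) b

balanced-hole-domino : ∀ m (h v : ℕ → Bool) → (∀ j → j < m → h j ≡ true) →
  h m ≡ false → h (suc m) ≡ false → v (suc m) ≡ not (v m) → Balanced (2 + m) h v
balanced-hole-domino m h v prefix hₘ hₘ₊₁ vₘ₊₁ =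
  trans (tally-hole-domino m h v prefix hₘ hₘ₊₁ vₘ₊₁ false)
        (sym (tally-hole-domino m h v prefix hₘ hₘ₊₁ vₘ₊₁ true))

Grid : Set
Grid = ℕ → ℕ → Bool

hole : ℕ → ℕ → ℕ → Bool
hole s i j = (i <ᵇ s) ∧ (j <ᵇ s)

hole-true : ∀ {s i j} → i < s → j < s → hole s i j ≡ true
hole-true i<s j<s rewrite <ᵇ-true i<s | <ᵇ-true j<s = refl

hole-falseˡ : ∀ s i j → (i <ᵇ s) ≡ false → hole s i j ≡ false
hole-falseˡ s i j i≮s rewrite i≮s = refl

hole-falseʳ : ∀ s i j → (j <ᵇ s) ≡ false → hole s i j ≡ false
hole-falseʳ s i j j≮s rewrite j≮s = ∧-zeroʳ (i <ᵇ s)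

RowsBalanced : ℕ → ℕ → Grid → Set
RowsBalanced n s A = ∀ i → i < n → Balanced n (hole s i) (A i)

ColsBalanced : ℕ → ℕ → Grid → Set
ColsBalanced n s A = ∀ j → j < n → Balanced n (λ i → hole s i j) (λ i → A i j)

-- The new non-empty cells are (0 | 1 , 2 + s | 3 + s) and (2 + s | 3 + s , 0 | 1);
-- every other new cell lies in the hole.
border : ℕ → Bool → Grid → Grid
border s flip A 0             j             = flip xor (j ≡ᵇ 2 + s)
border s flip A 1             j             = not (flip xor (j ≡ᵇ 2 + s))
border s flip A (suc (suc i)) 0             = i ≡ᵇ s
border s flip A (suc (suc i)) 1             = not (i ≡ᵇ s)
border s flip A (suc (suc i)) (suc (suc j)) = A i j

border-rows : ∀ s flip A → RowsBalanced (2 + s) s A → RowsBalanced (4 + s) (2 + s) (border s flip A)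
border-rows s flip A rows 0 _ =
  balanced-hole-domino (2 + s) (hole (2 + s) 0) (border s flip A 0)
    (λ j j<2+s → hole-true (s≤s z≤n) j<2+s)
    (hole-falseʳ (2 + s) 0 (2 + s) (<ᵇ-irrefl (2 + s))) (hole-falseʳ (2 + s) 0 (3 + s) (suc<ᵇ-false (2 + s)))
    top-domino
  where
  top-domino : flip xor (3 + s ≡ᵇ 2 + s) ≡ not (flip xor (2 + s ≡ᵇ 2 + s))
  top-domino rewrite suc≡ᵇ-false s | ≡ᵇ-refl s = sym (not-distribʳ-xor flip true)
border-rows s flip A rows 1 _ =
  balanced-hole-domino (2 + s) (hole (2 + s) 1) (border s flip A 1)
    (λ j j<2+s → hole-true (s≤s (s≤s z≤n)) j<2+s)
    (hole-falseʳ (2 + s) 1 (2 + s) (<ᵇ-irrefl (2 + s))) (hole-falseʳ (2 + s) 1 (3 + s) (suc<ᵇ-false (2 + s)))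
    top-domino
  where
  top-domino : not (flip xor (3 + s ≡ᵇ 2 + s)) ≡ not (not (flip xor (2 + s ≡ᵇ 2 + s)))
  top-domino rewrite suc≡ᵇ-false s | ≡ᵇ-refl s = cong not (sym (not-distribʳ-xor flip true))
border-rows s flip A rows (suc (suc i)) (s≤s (s≤s i<2+s)) =
  balanced-cons-domino (2 + s) (hole (2 + s) (2 + i)) (border s flip A (2 + i)) refl refl (rows i i<2+s)

border-cols : ∀ s flip A → ColsBalanced (2 + s) s A → ColsBalanced (4 + s) (2 + s) (border s flip A)
border-cols s flip A cols 0 _ =
  balanced-hole-domino (2 + s) (λ i → hole (2 + s) i 0) (λ i → border s flip A i 0)
    (λ i i<2+s → hole-true i<2+s (s≤s z≤n))
    (hole-falseˡ (2 + s) (2 + s) 0 (<ᵇ-irrefl (2 + s))) (hole-falseˡ (2 + s) (3 + s) 0 (suc<ᵇ-false (2 + s)))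
    (trans (suc≡ᵇ-false s) (cong not (sym (≡ᵇ-refl s))))
border-cols s flip A cols 1 _ =
  balanced-hole-domino (2 + s) (λ i → hole (2 + s) i 1) (λ i → border s flip A i 1)
    (λ i i<2+s → hole-true i<2+s (s≤s (s≤s z≤n)))
    (hole-falseˡ (2 + s) (2 + s) 1 (<ᵇ-irrefl (2 + s))) (hole-falseˡ (2 + s) (3 + s) 1 (suc<ᵇ-false (2 + s)))
    (cong not (trans (suc≡ᵇ-false s) (cong not (sym (≡ᵇ-refl s)))))
border-cols s flip A cols (suc (suc j)) (s≤s (s≤s j<2+s)) =
  balanced-cons-domino (2 + s) (λ i → hole (2 + s) i (2 + j)) (λ i → border s flip A i (2 + j))
    refl refl (cols j j<2+s)

pairCell : ℕ → Grid → Grid → Bool → Bool → ℕ → ℕ → Bool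
pairCell s A B a b i j = not (hole s i j) ∧ ((A i j =ᵇ a) ∧ (B i j =ᵇ b))

pairTally : ℕ → ℕ → Grid → Grid → Bool → Bool → ℕ
pairTally n s A B a b = count² n n (pairCell s A B a b)

pairCell-hole : ∀ s A B a b i j → hole s i j ≡ true → pairCell s A B a b i j ≡ false
pairCell-hole s A B a b i j inside rewrite inside = refl

opposite-cells : ∀ x a b → bit ((x =ᵇ a) ∧ (not x =ᵇ b)) + bit ((not x =ᵇ a) ∧ (x =ᵇ b)) ≡ bit (a xor b)
opposite-cells false false false = refl
opposite-cells false false true  = refl
opposite-cells false true  false = refl
opposite-cells false true  true  = refl
opposite-cells true  false false = refl
opposite-cells true  false true  = refl
opposite-cells true  true  false = refl
opposite-cells true  true  true  = refl

equal-cells : ∀ x a b → bit ((x =ᵇ a) ∧ (x =ᵇ b)) + bit ((not x =ᵇ a) ∧ (not x =ᵇ b)) ≡ bit (not (a xor b))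
equal-cells false false false = refl
equal-cells false false true  = refl
equal-cells false true  false = refl
equal-cells false true  true  = refl
equal-cells true  false false = refl
equal-cells true  false true  = refl
equal-cells true  true  false = refl
equal-cells true  true  true  = refl

two-of-each : ∀ x n → bit x + (bit x + (bit (not x) + (bit (not x) + n))) ≡ 2 + n
two-of-each false n = refl
two-of-each true  n = refl

module _ (s : ℕ) (A B : Grid) (a b : Bool) where

  private
    q : ℕ → ℕ → Bool
    q = pairCell (2 + s) (border s false A) (border s true B) a b

  top-pairs : ∀ r → r < 2 → count (4 + s) (q r) ≡ bit (a xor b)
  top-pairs r r<2
    rewrite count-false-prefix (2 + s) (q r) (λ j j<2+s → pairCell-hole (2 + s) (border s false A)
              (border s true B) a b r j (hole-true (≤-trans r<2 (m≤m+n 2 s)) j<2+s))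
    = top-cells r r<2
    where
    top-cells : ∀ r → r < 2 → bit (q r (2 + s)) + bit (q r (3 + s)) ≡ bit (a xor b)
    top-cells 0 _ rewrite <ᵇ-irrefl s | suc<ᵇ-false s | ≡ᵇ-refl s | suc≡ᵇ-false s = opposite-cells true a b
    top-cells 1 _ rewrite <ᵇ-irrefl s | suc<ᵇ-false s | ≡ᵇ-refl s | suc≡ᵇ-false s = opposite-cells false a b
    top-cells (suc (suc _)) (s≤s (s≤s ()))

  left-pairs : ∀ c → c < 2 → count (2 + s) (λ i → q (2 + i) c) ≡ bit (not (a xor b))
  left-pairs c c<2
    rewrite count-false-prefix s (λ i → q (2 + i) c) (λ i i<s → pairCell-hole (2 + s) (border s false A)
              (border s true B) a b (2 + i) c (hole-true (s≤s (s≤s i<s)) (≤-trans c<2 (m≤m+n 2 s))))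
    = left-cells c c<2
    where
    left-cells : ∀ c → c < 2 → bit (q (2 + s) c) + bit (q (3 + s) c) ≡ bit (not (a xor b))
    left-cells 0 _ rewrite <ᵇ-irrefl s | suc<ᵇ-false s | ≡ᵇ-refl s | suc≡ᵇ-false s = equal-cells true a b
    left-cells 1 _ rewrite <ᵇ-irrefl s | suc<ᵇ-false s | ≡ᵇ-refl s | suc≡ᵇ-false s = equal-cells false a b
    left-cells (suc (suc _)) (s≤s (s≤s ()))

  border-pairTally : pairTally (4 + s) (2 + s) (border s false A) (border s true B) a b ≡
                     2 + pairTally (2 + s) s A B a b
  border-pairTally = begin
    count² (4 + s) (4 + s) q
      ≡⟨ count²-peel (2 + s) q ⟩
    count (4 + s) (q 0) + (count (4 + s) (q 1) +
      (count (2 + s) (λ i → q (2 + i) 0) + (count (2 + s) (λ i → q (2 + i) 1) + inner)))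
      ≡⟨ cong₂ _+_ (top-pairs 0 (s≤s z≤n)) (cong₂ _+_ (top-pairs 1 (s≤s (s≤s z≤n)))
           (cong₂ _+_ (left-pairs 0 (s≤s z≤n)) (cong (_+ inner) (left-pairs 1 (s≤s (s≤s z≤n)))))) ⟩
    bit (a xor b) + (bit (a xor b) + (bit (not (a xor b)) + (bit (not (a xor b)) + inner)))
      ≡⟨ two-of-each (a xor b) inner ⟩
    2 + inner ∎
    where
    inner : ℕ
    inner = pairTally (2 + s) s A B a b

row : Bool → Bool → Bool → Bool → ℕ → Bool
row a b c d 0 = a
row a b c d 1 = b
row a b c d 2 = c
row a b c d 3 = d
row a b c d _ = false

-- No orthogonal pair of 2 × 2 frequency squares exists, so the recursion
-- starts from this pair of type (4; 2).
base : Bool → Grid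
base false 0 = row false false false true
base false 1 = row false false false true
base false 2 = row false true  true  false
base false 3 = row true  false true  false
base true  0 = row false false false true
base true  1 = row false false true  false
base true  2 = row false false true  true
base true  3 = row true  true  false false
base _     _ = λ _ → false

base-rows : ∀ flip → RowsBalanced 4 2 (base flip)
base-rows false 0 _ = refl
base-rows false 1 _ = refl
base-rows false 2 _ = refl
base-rows false 3 _ = refl
base-rows true  0 _ = refl
base-rows true  1 _ = refl
base-rows true  2 _ = refl
base-rows true  3 _ = refl
base-rows _ (suc (suc (suc (suc _)))) (s≤s (s≤s (s≤s (s≤s ()))))

base-cols : ∀ flip → ColsBalanced 4 2 (base flip)
base-cols false 0 _ = refl
base-cols false 1 _ = refl
base-cols false 2 _ = refl
base-cols false 3 _ = refl
base-cols true  0 _ = refl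
base-cols true  1 _ = refl
base-cols true  2 _ = refl
base-cols true  3 _ = refl
base-cols _ (suc (suc (suc (suc _)))) (s≤s (s≤s (s≤s (s≤s ()))))

base-pairTally : ∀ a b → pairTally 4 2 (base false) (base true) a b ≡ 3
base-pairTally false false = refl
base-pairTally false true  = refl
base-pairTally true  false = refl
base-pairTally true  true  = refl

twice : ℕ → ℕ
twice zero    = 0
twice (suc k) = suc (suc (twice k))

2*≡twice : ∀ k → 2 * k ≡ twice k
2*≡twice zero    = refl
2*≡twice (suc k) = trans (*-suc 2 k) (cong (2 +_) (2*≡twice k))

square : Bool → ℕ → Grid
square flip zero    = base flip
square flip (suc p) = border (twice (suc p)) flip (square flip p)

square-rows : ∀ flip p → RowsBalanced (twice (2 + p)) (twice (1 + p)) (square flip p)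
square-rows flip zero    = base-rows flip
square-rows flip (suc p) = border-rows (twice (suc p)) flip (square flip p) (square-rows flip p)

square-cols : ∀ flip p → ColsBalanced (twice (2 + p)) (twice (1 + p)) (square flip p)
square-cols flip zero    = base-cols flip
square-cols flip (suc p) = border-cols (twice (suc p)) flip (square flip p) (square-cols flip p)

square-pairTally : ∀ p a b →
  pairTally (twice (2 + p)) (twice (1 + p)) (square false p) (square true p) a b ≡ suc (twice (1 + p))
square-pairTally zero    a b = base-pairTally a b
square-pairTally (suc p) a b =
  trans (border-pairTally (twice (suc p)) (square false p) (square true p) a b)
        (cong (2 +_) (square-pairTally p a b))

toArray : (n : ℕ) → Grid → Array n
toArray n A i j = A (toℕ i) (toℕ j)

rowCount-toArray : ∀ {n} s A (i : Fin n) b →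
  rowCount s (toArray n A) i b ≡ tally n (hole s (toℕ i)) (A (toℕ i)) b
rowCount-toArray {n} s A i b = length-filter-tabulate _ n id _ (λ _ → refl)

colCount-toArray : ∀ {n} s A (j : Fin n) b →
  colCount s (toArray n A) j b ≡ tally n (λ i → hole s i (toℕ j)) (λ i → A i (toℕ j)) b
colCount-toArray {n} s A j b = length-filter-tabulate _ n id _ (λ _ → refl)

pairCount-toArray : ∀ n s A B a b → pairCount s (toArray n A) (toArray n B) a b ≡ pairTally n s A B a b
pairCount-toArray n s A B a b = length-filter-cells _ n id (pairCell s A B a b) (λ _ _ → refl)

isIFS-toArray : ∀ n s A → RowsBalanced n s A → ColsBalanced n s A → IsIFS n s (toArray n A)
isIFS-toArray n s A rows cols =
  (λ i → trans (rowCount-toArray s A i false)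
           (trans (rows (toℕ i) (toℕ<n i)) (sym (rowCount-toArray s A i true)))) ,
  (λ j → trans (colCount-toArray s A j false)
           (trans (cols (toℕ j) (toℕ<n j)) (sym (colCount-toArray s A j true))))

orthogonal-toArray : ∀ n s A B c → (∀ a b → pairTally n s A B a b ≡ c) →
                     Orthogonal n s (toArray n A) (toArray n B)
orthogonal-toArray n s A B c uniform = same false true , same true false , same true true
  where
  same : ∀ a b → pairCount s (toArray n A) (toArray n B) false false ≡
                 pairCount s (toArray n A) (toArray n B) a b
  same a b = begin
    pairCount s (toArray n A) (toArray n B) false false ≡⟨ pairCount-toArray n s A B false false ⟩
    pairTally n s A B false false                       ≡⟨ uniform false false ⟩
    c                                                   ≡⟨ uniform a b ⟨
    pairTally n s A B a b                               ≡⟨ pairCount-toArray n s A B a b ⟨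
    pairCount s (toArray n A) (toArray n B) a b         ∎

twoIMOFS-twice : ∀ p → TwoIMOFS (twice (2 + p)) (twice (1 + p))
twoIMOFS-twice p =
  toArray n (square false p) , toArray n (square true p) ,
  isIFS-toArray n s (square false p) (square-rows false p) (square-cols false p) ,
  isIFS-toArray n s (square true p) (square-rows true p) (square-cols true p) ,
  orthogonal-toArray n s (square false p) (square true p) (suc s) (square-pairTally p)
  where
  n s : ℕ
  n = twice (2 + p)
  s = twice (1 + p)

lemma6p4 : (n k : ℕ) → n ≡ 2 * k → 4 ≤ n → TwoIMOFS n (n ∸ 2)
lemma6p4 _ zero          refl ()
lemma6p4 _ (suc zero)    refl (s≤s (s≤s ()))
lemma6p4 _ (suc (suc p)) refl _ =
  subst (λ n → TwoIMOFS n (n ∸ 2)) (sym (2*≡twice (2 + p))) (twoIMOFS-twice p)
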